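{- Let $P$ be a protocol that solves the Ordered Response problem $\mathsf{OR}\langle e_{\mathtt t},\alpha_1,\ldots,\alpha_k\rangle$ in the synchronous context $\gamma^{\max}$, and let $r\in\mathcal R(P,\gamma^{\max})$ be a run in which the trigger $e_{\mathtt t}$ occurs at the node $(i_0,t)$. If process $i_k$ performs $a_k$ (i.e. the response $\alpha_k$) at time $t'$ in $r$, then there is a centipede for $\langle i_0,\ldots,i_k\rangle$ in the interval $(r,t..t')$.
   Context: Model: a finite set of processes communicates over a directed network; each channel $i\to j$ has a known integer upper bound $b_{ij}\ge 1$ on transmission time. Time is global and discrete ($0,1,2,\dots$), and every local state contains the current time. In the context $\gamma^{\max}$, a message sent on $i\to j$ at time $s$ is received at a nondeterministically chosen time in $[s+1,s+b_{ij}]$; processes may also receive external inputs, chosen nondeterministically and independently of the past. A protocol prescribes each process's actions as a function of its local state; $\mathcal R(P,\gamma^{\max})$ is the set of all runs of $P$ in this context. A node $(i,t)$ denotes process $i$ at time $t$. Transmission distance $D(i,j)$: shortest-path distance from $i$ to $j$ in the network weighted by the $b_{ij}$ ($D(i,i)=0$). Bound guarantee: $(i,t)\dashrightarrow(j,t')$ iff $t+D(i,j)\le t'$. Syncausality $\rightsquigarrow$ in a run $r$: the smallest relation on nodes such that (1) $(i,t)\rightsquigarrow(i,t')$ whenever $t\le t'$; (2) $(i,t)\rightsquigarrow(j,t')$ if some message sent at $(i,t)$ is received at $(j,t')$; (3) $(i,t)\rightsquigarrow(j,t+b_{ij})$ if $j$ is a neighbour of $i$ and $i$ sends no message to $j$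 at time $t$; (4) it is transitive. Centipede: for processes $i_0,\ldots,i_k$ and $t\le t'$, a centipede for $\langle i_0,\ldots,i_k\rangle$ in $(r,t..t')$ is a sequence of nodes $\theta_0\rightsquigarrow\theta_1\rightsquigarrow\cdots\rightsquigarrow\theta_k$ (in $r$) with $\theta_0=(i_0,t)$, $\theta_k=(i_k,t')$ and $\theta_h\dashrightarrow(i_h,t')$ for $h=1,\ldots,k-1$. Ordered Response $\mathsf{OR}\langle e_{\mathtt t},\alpha_1,\ldots,\alpha_k\rangle$: $e_{\mathtt t}$ is an external input (trigger) at process $i_0$, occurring at most once per run; each response $\alpha_h$ is the performance of an action $a_h$ by process $i_h$. $P$ solves it if in every run of $\mathcal R(P,\gamma^{\max})$ the responses are performed only if $e_{\mathtt t}$ occurs, are all performed when $e_{\mathtt t}$ occurs, and are performed in order: if $e_{\mathtt t}$ occurs at time $t$ and $\alpha_h$ at time $t_h$, then $t\le t_1\le\cdots\le t_k$. -}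

module Defs where

open import Data.Nat using (ℕ; zero; suc; _+_; _≤_; _<_; _≡ᵇ_; _≤ᵇ_)
open import Data.Fin using (Fin; _≟_)
open import Data.Bool using (Bool; true; false; if_then_else_; _∧_)
open import Data.Maybe using (Maybe; just; nothing)
open import Data.List using (List; []; _∷_; _++_; map; length; concatMap; allFin)
open import Data.List.Membership.Propositional using (_∈_)
open import Data.Product using (Σ; ∃; _×_; _,_)
open import Relation.Nullary.Decidable using (⌊_⌋)
open import Relation.Binary.PropositionalEquality using (_≡_)

-- The model is parametrised by:
--   n      : number of processes (processes are Fin n)
--   b i j  : bound on transmission time of channel i→j; b i j = 0 encodes
--            "no channel i→j", b i j ≥ 1 is the (integer, ≥ 1) bound of an
--            existing channel.
--   Msg    : message contents, Act : (non-send) actions, Ext : external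
--            inputs other than the trigger.
module Model (n : ℕ) (b : Fin n → Fin n → ℕ) (Msg Act Ext : Set) where

  Node : Set
  Node = Fin n × ℕ

  chan? : Fin n → Fin n → Bool
  chan? i j = 1 ≤ᵇ b i j

  data Path : Fin n → Fin n → ℕ → Set where
    here : ∀ {i} → Path i i 0
    step : ∀ {i j l w} → 1 ≤ b i j → Path j l w → Path i l (b i j + w)

  -- D(i,j) = d : d is the shortest-path distance (unreachable = no d, i.e. ∞)
  IsDist : Fin n → Fin n → ℕ → Set
  IsDist i j d = Path i j d × (∀ w → Path i j w → d ≤ w)

  _⇢_ : Node → Node → Set
  (i , t) ⇢ (j , t') = Σ ℕ λ d → IsDist i j d × t + d ≤ t'

  record Obs : Set where
    constructor obs
    field
      trig   : Bool
      inputs : List Ext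
      recv   : List (Fin n × Msg)

  -- local state at time m: the full local history (newest first),
  -- of length m+1, so it contains the current time
  LocalState : Set
  LocalState = List Obs

  record Protocol : Set where
    field
      send : Fin n → LocalState → Fin n → List Msg
      acts : Fin n → LocalState → List Act
  open Protocol public

  -- nondeterministic choices of the environment in γ^max
  record Env : Set where
    field
      trigTime : Maybe ℕ
      input    : Fin n → ℕ → List Ext
      delay    : Fin n → Fin n → ℕ → ℕ → ℕ     -- delay i j sendtime msgindex
  open Env public

  Admissible : Env → Set
  Admissible e = ∀ i j s idx → 1 ≤ b i j →
    1 ≤ delay e i j s idx × delay e i j s idx ≤ b i j

  out : Protocol → Fin n → LocalState → Fin n → List Msg
  out P i ls j = if chan? i j then send P i ls j else []

  arrive : (ℕ → ℕ) → ℕ → ℕ → ℕ → List Msg → List Msg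
  arrive d s' s idx [] = []
  arrive d s' s idx (m ∷ ms) =
    if s' + d idx ≡ᵇ s then m ∷ arrive d s' s (suc idx) ms
    else arrive d s' s (suc idx) ms

  -- messages arriving at j at time s, given the global history before s
  -- (list of global observations, newest first)
  received : Protocol → Env → ℕ → List (Fin n → Obs) → Fin n → List (Fin n × Msg)
  received P e s [] j = []
  received P e s (g ∷ rest) j =
    concatMap (λ i → map (λ m → (i , m))
      (arrive (delay e i j (length rest)) (length rest) s 0
              (out P i (map (λ f → f i) (g ∷ rest)) j)))
      (allFin n)
    ++ received P e s rest j

  isTrig : Fin n → Env → Fin n → ℕ → Bool
  isTrig i0 e i s with trigTime e
  ... | nothing = false
  ... | just t  = ⌊ i ≟ i0 ⌋ ∧ (t ≡ᵇ s)

  globalObs : Fin n → Protocol → Env → ℕ → List (Fin n → Obs) → Fin n → Obs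
  globalObs i0 P e s gh j = obs (isTrig i0 e j s) (input e j s) (received P e s gh j)

  ghist : Fin n → Protocol → Env → ℕ → List (Fin n → Obs)
  ghist i0 P e zero = globalObs i0 P e 0 [] ∷ []
  ghist i0 P e (suc m) = globalObs i0 P e (suc m) (ghist i0 P e m) ∷ ghist i0 P e m

  local : Fin n → Protocol → Env → Fin n → ℕ → LocalState
  local i0 P e i m = map (λ f → f i) (ghist i0 P e m)

  sentAt : Fin n → Protocol → Env → Fin n → ℕ → Fin n → List Msg
  sentAt i0 P e i t j = out P i (local i0 P e i t) j

  Performs : Fin n → Protocol → Env → Fin n → Act → ℕ → Set
  Performs i0 P e i a s = a ∈ acts P i (local i0 P e i s)

  data Syn (i0 : Fin n) (P : Protocol) (e : Env) : Node → Node → Set where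
    loc   : ∀ {i t t'} → t ≤ t' → Syn i0 P e (i , t) (i , t')
    msg   : ∀ {i j t idx} → idx < length (sentAt i0 P e i t j) →
            Syn i0 P e (i , t) (j , t + delay e i j t idx)
    null  : ∀ {i j t} → 1 ≤ b i j → sentAt i0 P e i t j ≡ [] →
            Syn i0 P e (i , t) (j , t + b i j)
    trans : ∀ {x y z} → Syn i0 P e x y → Syn i0 P e y z → Syn i0 P e x z

  -- Ordered Response OR⟨e_t, α_1..α_k⟩: trigger at ι 0, response α_h is
  -- action a h performed by process ι h (1 ≤ h ≤ k).

  Solves : (ι : ℕ → Fin n) (a : ℕ → Act) (k : ℕ) → Protocol → Set
  Solves ι a k P = ∀ (e : Env) → Admissible e →
      (∀ h s → 1 ≤ h → h ≤ k → Performs (ι 0) P e (ι h) (a h) s →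
         ∃ λ t → trigTime e ≡ just t)
    × (∀ t → trigTime e ≡ just t → ∀ h → 1 ≤ h → h ≤ k →
         ∃ λ s → Performs (ι 0) P e (ι h) (a h) s)
    × (∀ t → trigTime e ≡ just t →
         (∀ s → 1 ≤ k → Performs (ι 0) P e (ι 1) (a 1) s → t ≤ s)
       × (∀ h s s' → 1 ≤ h → h < k →
            Performs (ι 0) P e (ι h) (a h) s →
            Performs (ι 0) P e (ι (suc h)) (a (suc h)) s' → s ≤ s'))

  Centipede : Protocol → Env → (ι : ℕ → Fin n) (k t t' : ℕ) → Set
  Centipede P e ι k t t' = t ≤ t' × Σ (ℕ → Node) λ θ →
      θ 0 ≡ (ι 0 , t)
    × θ k ≡ (ι k , t')
    × (∀ h → h < k → Syn (ι 0) P e (θ h) (θ (suc h)))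
    × (∀ h → 1 ≤ h → h < k → θ h ⇢ (ι h , t'))

module Submission where

-- The proof is the slow-down argument.  The past of a node θ is the set of
-- nodes x with x ↝ θ; it is decidable (past?).  The slowed environment keeps
-- the delay of a message only if it is sent and received in the past of θ and
-- gives every other message the maximal delay b i j.  Local states in the past
-- of θ coincide in both runs (local-agrees), and a syncausal chain of the
-- slowed run is either no faster than the bound guarantee (outside-fits) or is
-- followed by the original run inside the past first (inside-shadow, lift-chain).
--   * The trigger precedes every response: otherwise the slowed run without
--     trigger would still perform it (trigger-precedes).
--   * Induction on h: slowed down outside the past of (ι (h+1) , s), the run
--     performs α_h at some s₁ ≤ s, and the centipede for α_h lifts back to the
--     original run (lift-centipede, next-centipede).

open import Defs
open import Data.Nat using (ℕ; zero; suc; _+_; _∸_; _≤_; _<_; z≤n; s≤s; _≤?_; _≡ᵇ_)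
open import Data.Bool using (if_then_else_; _∧_)
open import Data.Nat.Properties
  using ( ≤-refl; ≤-trans; ≤-reflexive; <-≤-trans; ≤-pred; n≤1+n; n<1+n; m≤m+n; m≤n+m
        ; m<m+n; m<n⇒m<1+n; +-identityʳ; +-assoc; +-suc; +-monoˡ-≤; +-monoʳ-≤; m+[n∸m]≡n; m+n∸m≡n
        ; m+n≡0⇒m≡0; ∸-monoʳ-<; ≮⇒≥; <⇒≱; 1+n≰n; m≤n⇒m<n∨m≡n; anyUpTo?
        ; module ≤-Reasoning)
  renaming (_≟_ to _≟ℕ_)
open import Data.Fin using (Fin; _≟_)
open import Data.Fin.Properties using (any?)
open import Data.Maybe using (Maybe; just; nothing)
open import Data.List using (List; []; _∷_; _++_; map; length; allFin)
open import Data.List.Properties using (concatMap-cong)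
open import Data.List.Membership.Propositional using (_∈_)
open import Data.Product using (Σ; ∃; _×_; _,_; proj₁; proj₂)
open import Data.Sum using (_⊎_; inj₁; inj₂; [_,_]′)
open import Data.Empty using (⊥-elim)
open import Function using (_∘_; id)
open import Relation.Nullary using (Dec; yes; no; ¬_)
open import Relation.Nullary.Decidable using (map′; _×-dec_; ⌊_⌋; toSum; dec-false; decidable-stable)
open import Data.Nat.Induction using (<-rec)
open import Relation.Binary.PropositionalEquality
  using (_≡_; _≢_; refl; sym; cong; cong₂; subst; subst₂)
  renaming (trans to infixr 5 _⨾_)

_then?_ : ∀ {A B : Set} → Dec A → (A → Dec B) → Dec (A × B)
no ¬a then? _  = no (¬a ∘ proj₁)
yes a then? b? = map′ (a ,_) proj₂ (b? a)

IsLeast : (ℕ → Set) → ℕ → Set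
IsLeast Q d = Q d × (∀ w → Q w → d ≤ w)

least : ∀ {Q : ℕ → Set} → (∀ w → Dec (Q w)) → ∀ {w} → Q w → ∃ (IsLeast Q)
least {Q} Q? {w} = <-rec (λ w → Q w → ∃ (IsLeast Q)) search w
  where
  search : ∀ w → (∀ {v} → v < w → Q v → ∃ (IsLeast Q)) → Q w → ∃ (IsLeast Q)
  search w smaller q with anyUpTo? Q? w
  ... | yes (v , v<w , qv) = smaller v<w qv
  ... | no none            = w , q , λ w' q' → ≮⇒≥ λ w'<w → none (w' , w'<w , q')

Chain : ∀ {A : Set} → (A → A → Set) → (ℕ → A) → ℕ → Set
Chain R ρ m = ∀ h → h < m → R (ρ h) (ρ (suc h))

extend : ∀ {A : Set} → (ℕ → A) → ℕ → A → ℕ → A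
extend ρ m z h with h ≤? m
... | yes _ = ρ h
... | no _  = z

extend-≤ : ∀ {A : Set} (ρ : ℕ → A) {m} (z : A) {h} → h ≤ m → extend ρ m z h ≡ ρ h
extend-≤ ρ {m} z {h} h≤m with h ≤? m
... | yes _   = refl
... | no h≰m  = ⊥-elim (h≰m h≤m)

extend-suc : ∀ {A : Set} (ρ : ℕ → A) m (z : A) → extend ρ m z (suc m) ≡ z
extend-suc ρ m z with suc m ≤? m
... | yes 1+m≤m = ⊥-elim (1+n≰n 1+m≤m)
... | no _      = refl

chain-extend : ∀ {A : Set} {R : A → A → Set} {ρ m z} →
  Chain R ρ m → R (ρ m) z → Chain R (extend ρ m z) (suc m)
chain-extend {R = R} {ρ} {m} {z} ch r h h<1+m with m≤n⇒m<n∨m≡n (≤-pred h<1+m)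
... | inj₁ h<m  = subst₂ R (sym (extend-≤ ρ z (≤-pred (m<n⇒m<1+n h<m))))
                           (sym (extend-≤ ρ z h<m)) (ch h h<m)
... | inj₂ refl = subst₂ R (sym (extend-≤ ρ z ≤-refl)) (sym (extend-suc ρ m z)) r

module Centipedes (n : ℕ) (b : Fin n → Fin n → ℕ) (Msg Act Ext : Set) where
  open Model n b Msg Act Ext

  time : Node → ℕ
  time = proj₂

  _++ᵖ_ : ∀ {i j l w w'} → Path i j w → Path j l w' → Path i l (w + w')
  here ++ᵖ q = q
  _++ᵖ_ {w' = w'} (step {i} {j} {w = w} c p) q rewrite +-assoc (b i j) w w' = step c (p ++ᵖ q)

  -- Every edge has positive weight, so a path of weight 0 is trivial …
  weight-zero : ∀ {i l w} → Path i l w → w ≡ 0 → i ≡ l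
  weight-zero here _ = refl
  weight-zero (step {i} {j} c _) eq = ⊥-elim (<⇒≱ c (≤-reflexive (m+n≡0⇒m≡0 (b i j) eq)))

  first-edge : ∀ {i l w} → Path i l (suc w) →
    ∃ λ j → Σ (1 ≤ b i j) λ _ → b i j ≤ suc w × Path j l (suc w ∸ b i j)
  first-edge p = split p refl
    where
    split : ∀ {i l v w} → Path i l v → v ≡ suc w →
      ∃ λ j → Σ (1 ≤ b i j) λ _ → b i j ≤ suc w × Path j l (suc w ∸ b i j)
    split here ()
    split (step {i} {j} {w = w'} c p) eq =
      j , c , subst (b i j ≤_) eq (m≤m+n (b i j) w') ,
      subst (Path j _) (sym (m+n∸m≡n (b i j) w') ⨾ cong (_∸ b i j) eq) p

  path? : ∀ w i l → Dec (Path i l w)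
  path? = <-rec (λ w → ∀ i l → Dec (Path i l w)) decide
    where
    decide : ∀ w → (∀ {v} → v < w → ∀ i l → Dec (Path i l v)) → ∀ i l → Dec (Path i l w)
    decide zero _ i l with i ≟ l
    ... | yes refl = yes here
    ... | no i≢l   = no λ p → i≢l (weight-zero p refl)
    decide (suc w) shorter i l = map′ join first-edge (any? edge?)
      where
      edge? : ∀ j → Dec (Σ (1 ≤ b i j) λ _ → b i j ≤ suc w × Path j l (suc w ∸ b i j))
      edge? j = (1 ≤? b i j) then? λ c →
                (b i j ≤? suc w) then? λ le → shorter (∸-monoʳ-< c le) j l
      join : (∃ λ j → Σ (1 ≤ b i j) λ _ → b i j ≤ suc w × Path j l (suc w ∸ b i j)) →
        Path i l (suc w)
      join (j , c , le , p) = subst (Path i l) (m+[n∸m]≡n le) (step c p)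

  -- (i , u) fits (j , s): some path from i to j fits into the time window
  -- u..s.  This is the bound guarantee without the minimality of the path,
  -- so it composes freely.
  Fits : Node → Node → Set
  Fits (i , u) (j , s) = Σ ℕ λ w → Path i j w × u + w ≤ s

  fits-refl : ∀ {i u s} → u ≤ s → Fits (i , u) (i , s)
  fits-refl u≤s = 0 , here , ≤-trans (≤-reflexive (+-identityʳ _)) u≤s

  fits-edge : ∀ {i j u s} → 1 ≤ b i j → u + b i j ≤ s → Fits (i , u) (j , s)
  fits-edge {i} {j} {u} c le = b i j + 0 , step c here , subst (λ v → u + v ≤ _) (sym (+-identityʳ (b i j))) le

  fits-trans : ∀ {x y z} → Fits x y → Fits y z → Fits x z
  fits-trans {_ , u} {_ , s} {_ , r} (w , p , u+w≤s) (w' , p' , s+w'≤r) =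
    w + w' , p ++ᵖ p' , (begin
      u + (w + w') ≡⟨ sym (+-assoc u w w') ⟩
      u + w + w'   ≤⟨ +-monoˡ-≤ w' u+w≤s ⟩
      s + w'       ≤⟨ s+w'≤r ⟩
      r            ∎)
    where open ≤-Reasoning

  -- A fitting path can be shortened to a shortest one: Fits is the bound guarantee.
  fits⇒⇢ : ∀ {x y} → Fits x y → x ⇢ y
  fits⇒⇢ {i , u} {j , s} (w , p , u+w≤s) with least (λ v → path? v i j) p
  ... | d , distance@(_ , shortest) = d , distance , ≤-trans (+-monoʳ-≤ u (shortest w p)) u+w≤s

  ⇢⇒fits : ∀ {x y} → x ⇢ y → Fits x y
  ⇢⇒fits (d , (p , _) , le) = d , p , le

  out-chan : ∀ P i ls j {idx} → idx < length (out P i ls j) → 1 ≤ b i j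
  out-chan P i ls j lt with b i j
  ... | zero  = ⊥-elim (<⇒≱ lt z≤n)
  ... | suc _ = s≤s z≤n

  isTrig-at : ∀ i0 e j u {t} → trigTime e ≡ just t → isTrig i0 e j u ≡ (⌊ j ≟ i0 ⌋ ∧ (t ≡ᵇ u))
  isTrig-at i0 e j u eqT with trigTime e
  isTrig-at i0 e j u refl | just _ = refl

  ghist-length : ∀ i0 P e m → length (ghist i0 P e m) ≡ suc m
  ghist-length i0 P e zero    = refl
  ghist-length i0 P e (suc m) = cong suc (ghist-length i0 P e m)

  InRange : ℕ → ℕ → ℕ → Set
  InRange k len m = k ≤ m × m < k + len

  range-head : ∀ k len → InRange k (suc len) k
  range-head k len = ≤-refl , m<m+n k (s≤s z≤n)

  range-tail : ∀ {k len m} → InRange (suc k) len m → InRange k (suc len) m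
  range-tail {k} {len} {m} (k<m , m<k+len) = ≤-trans (n≤1+n k) k<m , subst (m <_) (sym (+-suc k len)) m<k+len

  arrive-cong : ∀ (d d' : ℕ → ℕ) u s k L →
    (∀ m → InRange k (length L) m → (u + d m ≡ᵇ s) ≡ (u + d' m ≡ᵇ s)) →
    arrive d u s k L ≡ arrive d' u s k L
  arrive-cong d d' u s k [] _ = refl
  arrive-cong d d' u s k (x ∷ L) same =
    cong₂ (λ arrives rest → if arrives then x ∷ rest else rest)
      (same k (range-head k (length L)))
      (arrive-cong d d' u s (suc k) L λ m → same m ∘ range-tail)

  arrive-none : ∀ (d : ℕ → ℕ) u s k L →
    (∀ m → InRange k (length L) m → u + d m ≢ s) → arrive d u s k L ≡ []
  arrive-none d u s k [] _ = refl
  arrive-none d u s k (x ∷ L) late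
    rewrite dec-false (u + d k ≟ℕ s) (late k (range-head k (length L))) =
    arrive-none d u s (suc k) L λ m → late m ∘ range-tail

  module Run (i0 : Fin n) (P : Protocol) (e : Env) (adm : Admissible e) where

    infix 4 _↝_
    _↝_ : Node → Node → Set
    _↝_ = Syn i0 P e

    time-mono : ∀ {x y} → x ↝ y → time x ≤ time y
    time-mono (loc t≤t')  = t≤t'
    time-mono (msg _)     = m≤m+n _ _
    time-mono (null _ _)  = m≤m+n _ _
    time-mono (trans p q) = ≤-trans (time-mono p) (time-mono q)

    delay-positive : ∀ {i j u idx} → idx < length (sentAt i0 P e i u j) → 1 ≤ delay e i j u idx
    delay-positive {i} {j} {u} {idx} lt = proj₁ (adm i j u idx (out-chan P i _ j lt))

    -- Whether or not i sends to j at time u, (i , u) ↝ (j , u + b i j):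
    -- either nothing is sent, or the first message arrives no later.
    channel-syn : ∀ {i j u} → 1 ≤ b i j → (i , u) ↝ (j , u + b i j)
    channel-syn {i} {j} {u} c with sentAt i0 P e i u j in sent
    ... | []    = null c sent
    ... | _ ∷ _ = trans (msg {idx = 0} (subst (λ l → 0 < length l) (sym sent) (s≤s z≤n)))
                        (loc (+-monoʳ-≤ u (proj₂ (adm i j u 0 c))))

    path-syn : ∀ {i l w u} → Path i l w → (i , u) ↝ (l , u + w)
    path-syn {u = u} here = loc (≤-reflexive (sym (+-identityʳ u)))
    path-syn {i} {l} {u = u} (step {j = j} {w = w} c p) =
      trans (channel-syn c) (subst (λ v → (j , u + b i j) ↝ (l , v)) (+-assoc u (b i j) w) (path-syn p))

    fits-syn : ∀ {x y} → Fits x y → x ↝ y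
    fits-syn (w , p , u+w≤s) = trans (path-syn p) (loc u+w≤s)

    data Step : Node → Node → Set where
      tick    : ∀ {i u} → Step (i , u) (i , suc u)
      silent  : ∀ {i j u} → 1 ≤ b i j → sentAt i0 P e i u j ≡ [] → Step (i , u) (j , u + b i j)
      deliver : ∀ {i j u idx} → idx < length (sentAt i0 P e i u j) →
                Step (i , u) (j , u + delay e i j u idx)

    step-syn : ∀ {x y} → Step x y → x ↝ y
    step-syn tick           = loc (n≤1+n _)
    step-syn (silent c nil) = null c nil
    step-syn (deliver lt)   = msg lt

    first-step : ∀ {x y} → x ↝ y →
      (proj₁ x ≡ proj₁ y × time x ≤ time y) ⊎ ∃ λ z → Step x z × z ↝ y
    first-step (loc t≤t')  = inj₁ (refl , t≤t')
    first-step (msg lt)    = inj₂ (_ , deliver lt , loc ≤-refl)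
    first-step (null c s)  = inj₂ (_ , silent c s , loc ≤-refl)
    first-step (trans p q) with first-step p
    ... | inj₂ (z , st , z↝y) = inj₂ (z , st , trans z↝y q)
    ... | inj₁ (refl , u≤s) with m≤n⇒m<n∨m≡n u≤s
    ...   | inj₁ u<s  = inj₂ (_ , tick , trans (loc u<s) q)
    ...   | inj₂ refl = first-step q

    step? : ∀ {Q : Node → Set} x → (∀ z → time x < time z → Dec (Q z)) →
      Dec (∃ λ z → Step x z × Q z)
    step? {Q} (i , u) Q? with Q? (i , suc u) (n<1+n u) | any? silent? | any? deliver?
      where
      nil? : ∀ (xs : List Msg) → Dec (xs ≡ [])
      nil? []      = yes refl
      nil? (_ ∷ _) = no λ ()
      silent? : ∀ j → Dec (Σ (1 ≤ b i j) λ _ → sentAt i0 P e i u j ≡ [] × Q (j , u + b i j))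
      silent? j = (1 ≤? b i j) then? λ c → nil? _ ×-dec Q? _ (m<m+n u c)
      deliver? : ∀ j → Dec (∃ λ idx → idx < length (sentAt i0 P e i u j) ×
                   Σ (1 ≤ delay e i j u idx) λ _ → Q (j , u + delay e i j u idx))
      deliver? j = anyUpTo? (λ idx → (1 ≤? delay e i j u idx) then? λ c → Q? _ (m<m+n u c)) _
    ... | yes q | _ | _                         = yes (_ , tick , q)
    ... | _ | yes (_ , c , sent , q) | _        = yes (_ , silent c sent , q)
    ... | _ | _ | yes (_ , _ , lt , _ , q)      = yes (_ , deliver lt , q)
    ... | no ¬tick | no ¬silent | no ¬deliver = no λ where
      (_ , tick , q)           → ¬tick q
      (_ , silent c sent , q)  → ¬silent (_ , c , sent , q)
      (_ , deliver lt , q)     → ¬deliver (_ , _ , lt , delay-positive lt , q)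

    -- The syncausal past of a node θ, and its decidability: recursion on
    -- the time still left before θ, which every step shortens.
    module Past (θ : Node) where

      Past : Node → Set
      Past x = x ↝ θ

      past-before? : ∀ f x → time θ < time x + f → Dec (Past x)
      past-before? zero x θ<x = no λ p →
        <⇒≱ θ<x (≤-trans (≤-reflexive (+-identityʳ (time x))) (time-mono p))
      past-before? (suc f) (i , u) θ<u+f with (i ≟ proj₁ θ) ×-dec (u ≤? time θ)
      ... | yes (refl , u≤θ) = yes (loc u≤θ)
      ... | no ¬here = map′ (λ (_ , st , pz) → trans (step-syn st) pz)
                            (λ p → [ ⊥-elim ∘ ¬here , id ]′ (first-step p))
                            (step? (i , u) λ z u<z → past-before? f z (earlier z u<z))
        where
        earlier : ∀ z → u < time z → time θ < time z + f
        earlier z u<z = <-≤-trans θ<u+f (≤-trans (≤-reflexive (+-suc u f)) (+-monoˡ-≤ f u<z))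

      past? : ∀ x → Dec (Past x)
      past? x = past-before? (suc (time θ)) x (m≤n+m (suc (time θ)) (time x))

  module Slowed (i0 : Fin n) (P : Protocol) (e : Env) (adm : Admissible e) (θ : Node) where
    open Run i0 P e adm
    open Past θ

    slow : Fin n → Fin n → ℕ → ℕ → ℕ
    slow i j u idx with past? (i , u) ×-dec past? (j , u + delay e i j u idx)
    ... | yes _ = delay e i j u idx
    ... | no _  = b i j

    slow-inside : ∀ {i j u idx} → Past (i , u) → Past (j , u + delay e i j u idx) →
      slow i j u idx ≡ delay e i j u idx
    slow-inside {i} {j} {u} {idx} pi pj with past? (i , u) ×-dec past? (j , u + delay e i j u idx)
    ... | yes _ = refl
    ... | no outside = ⊥-elim (outside (pi , pj))

    slow-outside : ∀ {i j u idx} → ¬ (Past (i , u) × Past (j , u + delay e i j u idx)) →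
      slow i j u idx ≡ b i j
    slow-outside {i} {j} {u} {idx} outside with past? (i , u) ×-dec past? (j , u + delay e i j u idx)
    ... | yes inside = ⊥-elim (outside inside)
    ... | no _       = refl

    slowed : Maybe ℕ → Env
    slowed tr = record { trigTime = tr ; input = input e ; delay = slow }

    slowed-admissible : ∀ tr → Admissible (slowed tr)
    slowed-admissible tr i j u idx c with past? (i , u) ×-dec past? (j , u + delay e i j u idx)
    ... | yes _ = adm i j u idx c
    ... | no _  = c , ≤-refl

    untriggered : ∀ {t} → trigTime e ≡ just t → ¬ Past (i0 , t) →
      ∀ {j u} → Past (j , u) → isTrig i0 (slowed nothing) j u ≡ isTrig i0 e j u
    untriggered {t} eqT ¬p0 {j} {u} p rewrite isTrig-at i0 e j u eqT with j ≟ i0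
    ... | yes refl = sym (dec-false (t ≟ℕ u) λ t≡u → ¬p0 (subst (λ v → Past (i0 , v)) (sym t≡u) p))
    ... | no _     = refl

    module Agreement (tr : Maybe ℕ)
                     (same-trigger : ∀ {j u} → Past (j , u) → isTrig i0 (slowed tr) j u ≡ isTrig i0 e j u) where

      ê : Env
      ê = slowed tr

      Agree : ℕ → Set
      Agree u = ∀ {j} → Past (j , u) → local i0 P ê j u ≡ local i0 P e j u

      module Receiving (s : ℕ) (before : ∀ {u} → u < s → Agree u) {j : Fin n} (pj : Past (j , s)) where

        slow-arrivals arrivals : Fin n → ℕ → List Msg
        slow-arrivals i u = arrive (slow i j u) u s 0 (sentAt i0 P ê i u j)
        arrivals i u = arrive (delay e i j u) u s 0 (sentAt i0 P e i u j)

        -- A sender in the past of θ sends the same messages, and whether a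
        -- message arrives at s is unchanged: it keeps its delay, or it is
        -- received outside the past of θ, hence after s in both runs.
        past-sender : ∀ i {u} → u < s → Past (i , u) → slow-arrivals i u ≡ arrivals i u
        past-sender i {u} u<s pi =
          cong (arrive (slow i j u) u s 0 ∘ λ ls → out P i ls j) (before u<s pi)
          ⨾ arrive-cong (slow i j u) (delay e i j u) u s 0 (sentAt i0 P e i u j) λ m (_ , lt) →
              [ kept m , late m lt ]′ (toSum (past? (j , u + delay e i j u m)))
          where
          kept : ∀ m → Past (j , u + delay e i j u m) →
            (u + slow i j u m ≡ᵇ s) ≡ (u + delay e i j u m ≡ᵇ s)
          kept m pm = cong (λ d → u + d ≡ᵇ s) (slow-inside pi pm)
          late : ∀ m → m < length (sentAt i0 P e i u j) → ¬ Past (j , u + delay e i j u m) →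
            (u + slow i j u m ≡ᵇ s) ≡ (u + delay e i j u m ≡ᵇ s)
          late m lt ¬pm = cong (λ d → u + d ≡ᵇ s) (slow-outside (¬pm ∘ proj₂))
                        ⨾ dec-false (u + b i j ≟ℕ s) (¬pm ∘ before-s bound)
                        ⨾ sym (dec-false (u + delay e i j u m ≟ℕ s) (¬pm ∘ before-s ≤-refl))
            where
            bound : u + delay e i j u m ≤ u + b i j
            bound = +-monoʳ-≤ u (proj₂ (adm i j u m (out-chan P i _ j lt)))
            before-s : ∀ {v} → u + delay e i j u m ≤ v → v ≡ s → Past (j , u + delay e i j u m)
            before-s le refl = trans (loc le) pj

        sender-in-past : ∀ {i u v} → (i , u) ↝ (j , v) → v ≡ s → Past (i , u)
        sender-in-past i↝j refl = trans i↝j pj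

        outside-sender : ∀ i {u} → ¬ Past (i , u) → slow-arrivals i u ≡ arrivals i u
        outside-sender i {u} ¬pi = arrive-none (slow i j u) u s 0 (sentAt i0 P ê i u j) slowed-none
                                 ⨾ sym (arrive-none (delay e i j u) u s 0 (sentAt i0 P e i u j) none)
          where
          slowed-none : ∀ m → InRange 0 (length (sentAt i0 P ê i u j)) m → u + slow i j u m ≢ s
          slowed-none m (_ , lt) eq = ¬pi (sender-in-past (channel-syn (out-chan P i _ j lt))
            (cong (u +_) (sym (slow-outside (¬pi ∘ proj₁))) ⨾ eq))
          none : ∀ m → InRange 0 (length (sentAt i0 P e i u j)) m → u + delay e i j u m ≢ s
          none m (_ , lt) = ¬pi ∘ sender-in-past (msg lt)

        sender-agrees : ∀ i {u} → u < s → slow-arrivals i u ≡ arrivals i u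
        sender-agrees i {u} u<s = [ past-sender i u<s , outside-sender i ]′ (toSum (past? (i , u)))

        received-agrees : ∀ m → m < s → received P ê s (ghist i0 P ê m) j ≡ received P e s (ghist i0 P e m) j
        received-agrees zero 0<s =
          cong (_++ []) (concatMap-cong (λ i → cong (map (i ,_)) (sender-agrees i 0<s)) (allFin n))
        received-agrees (suc m) m<s
          rewrite ghist-length i0 P ê m | ghist-length i0 P e m =
          cong₂ _++_ (concatMap-cong (λ i → cong (map (i ,_)) (sender-agrees i m<s)) (allFin n))
                     (received-agrees m (≤-trans (n≤1+n _) m<s))

      local-agrees : ∀ u → Agree u
      local-agrees = <-rec Agree agree
        where
        agree : ∀ s → (∀ {u} → u < s → Agree u) → Agree s
        agree zero _ p = cong (λ x → obs x (input e _ 0) [] ∷ []) (same-trigger p)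
        agree (suc m) before {j} p =
          cong₂ _∷_ (cong₂ (λ x y → obs x (input e j (suc m)) y)
                           (same-trigger p)
                           (Receiving.received-agrees (suc m) before p m ≤-refl))
                    (before ≤-refl (trans (loc (n≤1+n m)) p))

      sent-agrees : ∀ {i u j} → Past (i , u) → sentAt i0 P ê i u j ≡ sentAt i0 P e i u j
      sent-agrees {i} {u} {j} pi = cong (λ ls → out P i ls j) (local-agrees u pi)

      performs-agrees : ∀ {j act u} → Past (j , u) → Performs i0 P e j act u → Performs i0 P ê j act u
      performs-agrees {j} {act} {u} pj = subst (λ ls → act ∈ acts P j ls) (sym (local-agrees u pj))

      infix 4 _↝̂_
      _↝̂_ : Node → Node → Set
      _↝̂_ = Syn i0 P ê

      open Run i0 P ê (slowed-admissible tr) using () renaming (fits-syn to fits-syn̂)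

      outside-fits : ∀ {x y} → x ↝̂ y → ¬ Past x → Fits x y
      outside-fits (loc t≤t') _ = fits-refl t≤t'
      outside-fits (msg {i} {j} {u} {idx} lt) ¬pi =
        fits-edge (out-chan P i _ j lt) (≤-reflexive (cong (u +_) (sym (slow-outside (¬pi ∘ proj₁)))))
      outside-fits (null c _) _ = fits-edge c ≤-refl
      outside-fits (trans {y = y} p q) ¬px with past? y
      ... | yes py = ⊥-elim (¬px (trans (fits-syn (outside-fits p ¬px)) py))
      ... | no ¬py = fits-trans (outside-fits p ¬px) (outside-fits q ¬py)

      inside-shadow : ∀ {x y} → x ↝̂ y → Past x → ∃ λ z → Past z × x ↝ z × Fits z y
      inside-shadow (loc t≤t') px = _ , px , loc ≤-refl , fits-refl t≤t'
      inside-shadow (msg {i} {j} {u} {idx} lt) pi =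
        [ kept , slowed-down ]′ (toSum (past? (j , u + delay e i j u idx)))
        where
        Shadow : Set
        Shadow = ∃ λ z → Past z × (i , u) ↝ z × Fits z (j , u + slow i j u idx)
        kept : Past (j , u + delay e i j u idx) → Shadow
        kept pj = _ , pj , msg (subst (λ l → idx < length l) (sent-agrees pi) lt)
                , fits-refl (≤-reflexive (cong (u +_) (sym (slow-inside pi pj))))
        slowed-down : ¬ Past (j , u + delay e i j u idx) → Shadow
        slowed-down ¬pj = _ , pi , loc ≤-refl
                        , fits-edge (out-chan P i _ j lt)
                                    (≤-reflexive (cong (u +_) (sym (slow-outside (¬pj ∘ proj₂)))))
      inside-shadow (null c _) pi = _ , pi , loc ≤-refl , fits-edge c ≤-refl
      inside-shadow (trans {y = y} p q) px with inside-shadow p px | past? y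
      ... | z , pz , x↝z , z⇢y | yes py =
        let (z' , pz' , y↝z' , z'⇢w) = inside-shadow q py
        in z' , pz' , trans (trans x↝z (fits-syn z⇢y)) y↝z' , z'⇢w
      ... | z , pz , x↝z , z⇢y | no ¬py = z , pz , x↝z , fits-trans z⇢y (outside-fits q ¬py)

      lift-chain : ∀ (θ̂ : ℕ → Node) m → Chain _↝̂_ θ̂ m → Past (θ̂ 0) →
        ∃ λ ρ → ρ 0 ≡ θ̂ 0 × Chain _↝_ ρ m × Past (ρ m) × (∀ h → h ≤ m → Fits (ρ h) (θ̂ h))
      lift-chain θ̂ zero _ p0 = (λ _ → θ̂ 0) , refl , (λ _ ()) , p0 , λ { _ z≤n → fits-refl ≤-refl }
      lift-chain θ̂ (suc m) ch p0 with lift-chain θ̂ m (λ h h<m → ch h (m<n⇒m<1+n h<m)) p0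
      ... | ρ , ρ0 , ρ-chain , pm , fit
          with inside-shadow (trans (fits-syn̂ (fit m ≤-refl)) (ch m ≤-refl)) pm
      ...   | z , pz , ρm↝z , z⇢ =
        extend ρ m z , extend-≤ ρ {m} z z≤n ⨾ ρ0 , chain-extend {R = _↝_} ρ-chain ρm↝z ,
        subst Past (sym (extend-suc ρ m z)) pz , fit′
        where
        fit′ : ∀ h → h ≤ suc m → Fits (extend ρ m z h) (θ̂ h)
        fit′ h h≤1+m with m≤n⇒m<n∨m≡n h≤1+m
        ... | inj₁ h<1+m = subst (λ x → Fits x (θ̂ h)) (sym (extend-≤ ρ z (≤-pred h<1+m)))
                                 (fit h (≤-pred h<1+m))
        ... | inj₂ refl  = subst (λ x → Fits x (θ̂ (suc m))) (sym (extend-suc ρ m z)) z⇢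

  module OrderedResponse (k : ℕ) (ι : ℕ → Fin n) (a : ℕ → Act) (P : Protocol) (sol : Solves ι a k P) where

    Responds : Env → ℕ → ℕ → Set
    Responds e h s = Performs (ι 0) P e (ι h) (a h) s

    only-if-triggered : ∀ {e} → Admissible e → ∀ {h s} → 1 ≤ h → h ≤ k → Responds e h s →
      ∃ λ t → trigTime e ≡ just t
    only-if-triggered adm {h} {s} = proj₁ (sol _ adm) h s

    all-respond : ∀ {e} → Admissible e → ∀ {t} → trigTime e ≡ just t → ∀ {h} → 1 ≤ h → h ≤ k →
      ∃ (Responds e h)
    all-respond adm eqT {h} = proj₁ (proj₂ (sol _ adm)) _ eqT h

    in-order : ∀ {e} → Admissible e → ∀ {t} → trigTime e ≡ just t → ∀ {h s s'} → 1 ≤ h → h < k →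
      Responds e h s → Responds e (suc h) s' → s ≤ s'
    in-order adm eqT {h} {s} {s'} = proj₂ (proj₂ (proj₂ (sol _ adm)) _ eqT) h s s'

    -- The trigger syncausally precedes every response: otherwise the run
    -- slowed down outside the past of the response node and stripped of
    -- its trigger would still perform the response.
    trigger-precedes : ∀ {e} → Admissible e → ∀ {t h s} → trigTime e ≡ just t → 1 ≤ h → h ≤ k →
      Responds e h s → Syn (ι 0) P e (ι 0 , t) (ι h , s)
    trigger-precedes {e} adm {t} {h} {s} eqT 1≤h h≤k responds =
      decidable-stable (past? (ι 0 , t)) λ ¬p0 →
        let open Agreement nothing (untriggered eqT ¬p0)
            (_ , never) = only-if-triggered (slowed-admissible nothing) 1≤h h≤k
                                            (performs-agrees (loc ≤-refl) responds)
        in nothing≢just never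
      where
      open Slowed (ι 0) P e adm (ι h , s)
      open Run.Past (ι 0) P e adm (ι h , s)
      nothing≢just : ∀ {t : ℕ} → nothing ≢ just t
      nothing≢just ()

    CentipedeFor : ℕ → Set
    CentipedeFor h = ∀ {e} → Admissible e → ∀ {t s} → trigTime e ≡ just t → Responds e h s →
      Centipede P e ι h t s

    first-centipede : 1 ≤ k → CentipedeFor 1
    first-centipede 1≤k {e} adm {t} {s} eqT responds =
      time-mono p0 , extend trigger 0 (ι 1 , s) , refl , extend-suc trigger 0 (ι 1 , s) ,
      chain-extend {R = _↝_} (λ _ ()) p0 , λ { _ (s≤s z≤n) (s≤s ()) }
      where
      trigger : ℕ → Node
      trigger _ = ι 0 , t
      open Run (ι 0) P e adm using (_↝_; time-mono)
      p0 : (ι 0 , t) ↝ (ι 1 , s)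
      p0 = trigger-precedes adm eqT ≤-refl 1≤k responds

    lift-centipede : ∀ {e} (adm : Admissible e) m {t s s₁} →
      let open Slowed (ι 0) P e adm (ι (suc m) , s) in
      Syn (ι 0) P e (ι 0 , t) (ι (suc m) , s) → s₁ ≤ s →
      Centipede P (slowed (trigTime e)) ι m t s₁ → Centipede P e ι (suc m) t s
    lift-centipede {e} adm m {t} {s} {s₁} p0 s₁≤s (_ , θ̂ , θ̂0 , θ̂m , θ̂-chain , θ̂-legs)
      with Agreement.lift-chain (trigTime e) (λ _ → refl) θ̂ m θ̂-chain (subst Past (sym θ̂0) p0)
      where open Slowed (ι 0) P e adm (ι (suc m) , s)
            open Run.Past (ι 0) P e adm (ι (suc m) , s)
    ... | ρ , ρ0 , ρ-chain , pm , fit =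
      time-mono p0 , extend ρ m θ , extend-≤ ρ {m} θ z≤n ⨾ ρ0 ⨾ θ̂0 , extend-suc ρ m θ ,
      chain-extend {R = _↝_} ρ-chain pm , legs
      where
      open Run (ι 0) P e adm using (_↝_; time-mono)
      θ : Node
      θ = ι (suc m) , s
      slowed-leg : ∀ h → 1 ≤ h → h ≤ m → Fits (θ̂ h) (ι h , s)
      slowed-leg h 1≤h h≤m with m≤n⇒m<n∨m≡n h≤m
      ... | inj₁ h<m  = fits-trans (⇢⇒fits (θ̂-legs h 1≤h h<m)) (fits-refl s₁≤s)
      ... | inj₂ refl = subst (λ x → Fits x (ι h , s)) (sym θ̂m) (fits-refl s₁≤s)
      legs : ∀ h → 1 ≤ h → h < suc m → extend ρ m θ h ⇢ (ι h , s)
      legs h 1≤h h<1+m = subst (_⇢ (ι h , s)) (sym (extend-≤ ρ θ (≤-pred h<1+m)))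
        (fits⇒⇢ (fits-trans (fit h (≤-pred h<1+m)) (slowed-leg h 1≤h (≤-pred h<1+m))))

    -- Induction step: slowed down outside the past of (ι (m+1) , s), the run
    -- still performs α_(m+1) at s, hence α_m at some s₁ ≤ s; the centipede
    -- for α_m in the slowed run lifts back to the original run.
    next-centipede : ∀ m → 1 ≤ m → suc m ≤ k → CentipedeFor m → CentipedeFor (suc m)
    next-centipede m 1≤m m<k centipede-m {e} adm {t} {s} eqT responds =
      lift-centipede adm m p0 s₁≤s (centipede-m (slowed-admissible (trigTime e)) eqT (proj₂ earlier))
      where
      open Slowed (ι 0) P e adm (ι (suc m) , s)
      open Agreement (trigTime e) (λ _ → refl)
      p0 : Syn (ι 0) P e (ι 0 , t) (ι (suc m) , s)
      p0 = trigger-precedes adm eqT (s≤s z≤n) m<k responds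
      earlier : ∃ (Responds ê m)
      earlier = all-respond (slowed-admissible (trigTime e)) eqT 1≤m (≤-trans (n≤1+n m) m<k)
      s₁≤s : proj₁ earlier ≤ s
      s₁≤s = in-order (slowed-admissible (trigTime e)) eqT 1≤m m<k
               (proj₂ earlier) (performs-agrees (loc ≤-refl) responds)

    centipede : ∀ h → 1 ≤ h → h ≤ k → CentipedeFor h
    centipede (suc zero)     _ 1≤k = first-centipede 1≤k
    centipede (suc (suc m)) _ h≤k =
      next-centipede (suc m) (s≤s z≤n) h≤k (centipede (suc m) (s≤s z≤n) (≤-trans (n≤1+n _) h≤k))

mainTheorem1 : (n : ℕ) (b : Fin n → Fin n → ℕ) (Msg Act Ext : Set) →
    let open Model n b Msg Act Ext in
    (k : ℕ) → 1 ≤ k → (ι : ℕ → Fin n) (a : ℕ → Act) (P : Protocol) →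
    Solves ι a k P →
    (e : Env) → Admissible e →
    (t t' : ℕ) → trigTime e ≡ just t →
    Performs (ι 0) P e (ι k) (a k) t' →
    Centipede P e ι k t t'
mainTheorem1 n b Msg Act Ext k 1≤k ι a P sol e adm t t' eqT responds =
  OrderedResponse.centipede k ι a P sol k 1≤k ≤-refl adm eqT responds
  where open Centipedes n b Msg Act Ext
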